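{- Let $X$, $Y$ be finite nonempty sets, $F: X\to 2^Y$ a set-valued mapping and $(W_1,\ldots,W_m)$ a Hall partition of $F$. Then (i) $W_1\cup\cdots\cup W_{i-1}$ is a critical set of $F$ for $i=2,\ldots,m$; (ii) $W_m$ is a critical set of $F_{W_1\cup\cdots\cup W_{m-1}}$ if and only if $\sharp F(X) = \sharp X$.
   Context: A set-valued mapping $F: X \to 2^Y$ assigns to each $x$ a (possibly empty) subset $F(x) \subset Y$; $F(W) = \bigcup_{x\in W}F(x)$; $\sharp$ is cardinality. For $W \subset X$, $F_W: X\setminus W \to 2^Y$ is $F_W(x) = F(x) \setminus F(W)$ ($F_\emptyset=F$). For set-valued $G$ on a finite set, a subset $W$ of its domain is critical for $G$ if $W\ne\emptyset$ and $\sharp G(W)=\sharp W$; non-reducible for $G$ if $W\ne\emptyset$ and no proper subset of $W$ is critical for $G$. A tuple $(W_1,\ldots,W_m)$, $m\ge1$, is a Hall partition of $F$ if the $W_i$ are nonempty, pairwise disjoint with union $X$, and with $G_i = F_{W_1\cup\cdots\cup W_{i-1}}$ ($G_1=F$): (i) $G_i(x)\neq\emptyset$ for $x \in W_i$; (ii) $W_i$ is non-reducible for $G_i$; (iii) $W_i$ is critical for $G_i$ for $i \le m-1$. -}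

module Defs where

open import Data.Nat using (ℕ; suc; _<ᵇ_; _+_; _<_)
open import Data.Bool using (if_then_else_)
open import Data.Fin using (Fin; toℕ)
open import Data.Fin.Subset using (Subset; _∈_; _⊆_; _⊂_; ⋃; ⊥; ∁; _─_; ∣_∣; Nonempty)
open import Data.Vec using (lookup)
open import Data.List using (map; allFin)
open import Data.Product using (_×_; ∃)
open import Relation.Binary.PropositionalEquality using (_≡_)
open import Relation.Nullary using (¬_)

-- X = Fin n, Y = Fin p.  A set-valued mapping F : X → 2^Y is a function Fin n → Subset p.
SetMap : ℕ → ℕ → Set
SetMap n p = Fin n → Subset p

image : ∀ {n p} → SetMap n p → Subset n → Subset p
image {n} F W = ⋃ (map (λ x → if lookup W x then F x else ⊥) (allFin n))

-- F_W(x) = F(x) \ F(W); its domain is X \ W = ∁ W (values outside are irrelevant)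
restrictMap : ∀ {n p} → SetMap n p → Subset n → SetMap n p
restrictMap F W x = F x ─ image F W

-- A set-valued map G with domain D ⊆ X.
-- W is critical for G (domain D): W ⊆ D, W ≠ ∅, ♯G(W) = ♯W.
IsCritical : ∀ {n p} → Subset n → SetMap n p → Subset n → Set
IsCritical D G W = (W ⊆ D) × Nonempty W × (∣ image G W ∣ ≡ ∣ W ∣)

IsNonReducible : ∀ {n p} → Subset n → SetMap n p → Subset n → Set
IsNonReducible D G W =
  (W ⊆ D) × Nonempty W × (∀ V → V ⊂ W → ¬ IsCritical D G V)

-- W_1 ∪ ... ∪ W_i (0-based family W : Fin m → Subset n, union of those with index < i)
prefixUnion : ∀ {m n} → (Fin m → Subset n) → ℕ → Subset n
prefixUnion {m} W i = ⋃ (map (λ j → if toℕ j <ᵇ i then W j else ⊥) (allFin m))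

-- G_i = F_{W_1 ∪ ... ∪ W_{i-1}} (0-based: index i uses union of indices < i), domain ∁ (prefix)
stageMap : ∀ {m n p} → SetMap n p → (Fin m → Subset n) → Fin m → SetMap n p
stageMap F W i = restrictMap F (prefixUnion W (toℕ i))

stageDom : ∀ {m n} → (Fin m → Subset n) → Fin m → Subset n
stageDom W i = ∁ (prefixUnion W (toℕ i))

-- (W_1,…,W_m) with m = suc k ≥ 1, indexed 0-based by Fin (suc k).
record IsHallPartition {n p k : ℕ} (F : SetMap n p) (W : Fin (suc k) → Subset n) : Set where
  field
    nonempty  : ∀ i → Nonempty (W i)
    disjoint  : ∀ i j (x : Fin n) → x ∈ W i → x ∈ W j → i ≡ j
    covers    : ∀ (x : Fin n) → ∃ λ i → x ∈ W i
    values    : ∀ i (x : Fin n) → x ∈ W i → Nonempty (stageMap F W i x)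
    nonReduc  : ∀ i → IsNonReducible (stageDom W i) (stageMap F W i) (W i)
    critical  : ∀ i → suc (toℕ i) < suc k → IsCritical (stageDom W i) (stageMap F W i) (W i)

{-# OPTIONS --safe #-}
-- Write U_i = W_1 ∪ ⋯ ∪ W_{i-1}. For any A, B the image splits disjointly as
-- F(A ∪ B) = F(A) ∪ F_A(B), and the W_i are disjoint, so
--   ♯F(U_{i+1}) = ♯F(U_i) + ♯G_i(W_i)   and   ♯U_{i+1} = ♯U_i + ♯W_i.
-- Since W_i is critical for G_i for i < m, induction gives ♯F(U_i) = ♯U_i, which is (i).
-- For i = m the same two identities, with U_{m+1} = X, show that ♯G_m(W_m) = ♯W_m
-- exactly when ♯F(X) = ♯X; the rest of criticality comes from non-reducibility.
module Submission where

open import Defs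
open import Data.Nat using (ℕ; zero; suc; _+_; _≤_; _<_; _<ᵇ_; s≤s; s≤s⁻¹)
open import Data.Nat.Properties
  using (<ᵇ⇒<; <⇒<ᵇ; <-irrefl; n≮0; ≤-refl; ≤-reflexive; <⇒≤; m≤n⇒m≤1+n; m≤n⇒m<n∨m≡n; +-suc; +-cancelˡ-≡)
open import Data.Bool using (Bool; true; false; if_then_else_; T)
open import Data.Unit using (tt)
open import Data.Fin using (Fin; zero; suc; toℕ; fromℕ; fromℕ<)
open import Data.Fin.Properties using (toℕ-injective; toℕ<n; toℕ-fromℕ; toℕ-fromℕ<)
open import Data.Fin.Subset using (Subset; _∈_; _∉_; _⊆_; _∪_; _─_; ⋃; ⊥; ⊤; ∣_∣)
open import Data.Fin.Subset.Properties
  using (∉⊥; ⊆⊤; ∣⊥∣≡0; ∣⊤∣≡n; ⊆-antisym; x∈p∪q⁻; x∈p∪q⁺; x∈p∧x∉q⇒x∈p─q; p─q⊆p; p⊆p∪q; q⊆p∪q; _∈?_)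
open import Data.Vec using ([]; _∷_; here; there; lookup)
open import Data.Vec.Properties using ([]=⇒lookup; lookup⇒[]=)
open import Data.List as List using (List; map; allFin)
open import Data.List.Relation.Unary.Any as Any using (Any; here; there; satisfied)
open import Data.List.Relation.Unary.Any.Properties using (map⁺; map⁻)
open import Data.List.Membership.Propositional.Properties using (∈-allFin)
open import Data.Product using (_×_; ∃; _,_; proj₁; proj₂)
open import Data.Sum using (inj₁; inj₂)
open import Data.Empty using (⊥-elim)
open import Relation.Binary.PropositionalEquality
  using (_≡_; refl; sym; trans; cong; cong₂; module ≡-Reasoning)
open import Relation.Nullary using (yes; no)
open import Function.Bundles using (_⇔_; mk⇔)

private
  variable
    m n p : ℕ

x∈p─q⇒x∉q : ∀ {x : Fin n} (P Q : Subset n) → x ∈ P ─ Q → x ∉ Q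
x∈p─q⇒x∉q (_ ∷ P) (_ ∷ Q) (there x∈P─Q) (there x∈Q) = x∈p─q⇒x∉q P Q x∈P─Q x∈Q

∣p∪q∣≡∣p∣+∣q∣ : (P Q : Subset n) → (∀ {x} → x ∈ P → x ∉ Q) → ∣ P ∪ Q ∣ ≡ ∣ P ∣ + ∣ Q ∣
∣p∪q∣≡∣p∣+∣q∣ []          []          _ = refl
∣p∪q∣≡∣p∣+∣q∣ (true ∷ P)  (true ∷ Q)  P∩Q≡∅ = ⊥-elim (P∩Q≡∅ here here)
∣p∪q∣≡∣p∣+∣q∣ (true ∷ P)  (false ∷ Q) P∩Q≡∅ = cong suc (∣p∪q∣≡∣p∣+∣q∣ P Q (λ x∈P x∈Q → P∩Q≡∅ (there x∈P) (there x∈Q)))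
∣p∪q∣≡∣p∣+∣q∣ (false ∷ P) (true ∷ Q)  P∩Q≡∅ =
  trans (cong suc (∣p∪q∣≡∣p∣+∣q∣ P Q (λ x∈P x∈Q → P∩Q≡∅ (there x∈P) (there x∈Q)))) (sym (+-suc ∣ P ∣ ∣ Q ∣))
∣p∪q∣≡∣p∣+∣q∣ (false ∷ P) (false ∷ Q) P∩Q≡∅ = ∣p∪q∣≡∣p∣+∣q∣ P Q (λ x∈P x∈Q → P∩Q≡∅ (there x∈P) (there x∈Q))

x∈⋃⁻ : ∀ {x : Fin n} (Ps : List (Subset n)) → x ∈ ⋃ Ps → Any (x ∈_) Ps
x∈⋃⁻ List.[]       x∈⋃ = ⊥-elim (∉⊥ x∈⋃)
x∈⋃⁻ (P List.∷ Ps) x∈⋃ with x∈p∪q⁻ P (⋃ Ps) x∈⋃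
... | inj₁ x∈P = here x∈P
... | inj₂ x∈⋃Ps = there (x∈⋃⁻ Ps x∈⋃Ps)

x∈⋃⁺ : ∀ {x : Fin n} {Ps : List (Subset n)} → Any (x ∈_) Ps → x ∈ ⋃ Ps
x∈⋃⁺ (here x∈P)  = x∈p∪q⁺ (inj₁ x∈P)
x∈⋃⁺ (there x∈Ps) = x∈p∪q⁺ (inj₂ (x∈⋃⁺ x∈Ps))

-- image and prefixUnion both unfold definitionally to instances of this union.
⋃-select : (Fin m → Bool) → (Fin m → Subset n) → Subset n
⋃-select {m} b f = ⋃ (map (λ j → if b j then f j else ⊥) (allFin m))

x∈⋃-select⁻ : ∀ {x : Fin n} (b : Fin m → Bool) (f : Fin m → Subset n) →
              x ∈ ⋃-select b f → ∃ λ j → T (b j) × x ∈ f j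
x∈⋃-select⁻ {m = m} b f x∈⋃ with satisfied (map⁻ {xs = allFin m} (x∈⋃⁻ _ x∈⋃))
... | j , x∈fj = j , selected (b j) x∈fj
  where
  selected : ∀ {x} c {P : Subset _} → x ∈ (if c then P else ⊥) → T c × x ∈ P
  selected true  x∈P = tt , x∈P
  selected false x∈⊥ = ⊥-elim (∉⊥ x∈⊥)

x∈⋃-select⁺ : ∀ {x : Fin n} (b : Fin m → Bool) (f : Fin m → Subset n) j →
              T (b j) → x ∈ f j → x ∈ ⋃-select b f
x∈⋃-select⁺ b f j bj x∈fj = x∈⋃⁺ (map⁺ (Any.map (λ { refl → selected (b j) bj x∈fj }) (∈-allFin j)))
  where
  selected : ∀ {x} c {P : Subset _} → T c → x ∈ P → x ∈ (if c then P else ⊥)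
  selected true _ x∈P = x∈P

T-lookup⇒∈ : ∀ (A : Subset n) y → T (lookup A y) → y ∈ A
T-lookup⇒∈ A y t with lookup A y in eq
... | true = lookup⇒[]= y A eq

∈⇒T-lookup : ∀ (A : Subset n) y → y ∈ A → T (lookup A y)
∈⇒T-lookup A y y∈A rewrite []=⇒lookup y∈A = tt

x∈image⁻ : ∀ {x} (F : SetMap n p) (A : Subset n) → x ∈ image F A → ∃ λ y → y ∈ A × x ∈ F y
x∈image⁻ F A x∈FA with x∈⋃-select⁻ (lookup A) F x∈FA
... | y , y∈A , x∈Fy = y , T-lookup⇒∈ A y y∈A , x∈Fy

x∈image⁺ : ∀ {x} (F : SetMap n p) (A : Subset n) y → y ∈ A → x ∈ F y → x ∈ image F A
x∈image⁺ F A y y∈A = x∈⋃-select⁺ (lookup A) F y (∈⇒T-lookup A y y∈A)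

image-⊥ : (F : SetMap n p) → image F ⊥ ≡ ⊥
image-⊥ F = ⊆-antisym (λ x∈F⊥ → ⊥-elim (∉⊥ (proj₁ (proj₂ (x∈image⁻ F ⊥ x∈F⊥))))) (λ x∈⊥ → ⊥-elim (∉⊥ x∈⊥))

image-mono : (F : SetMap n p) {A B : Subset n} → A ⊆ B → image F A ⊆ image F B
image-mono F {A} {B} A⊆B x∈FA with x∈image⁻ F A x∈FA
... | y , y∈A , x∈Fy = x∈image⁺ F B y (A⊆B y∈A) x∈Fy

image-restrictMap-⊆ : (F : SetMap n p) (A B : Subset n) → image (restrictMap F A) B ⊆ image F B
image-restrictMap-⊆ F A B x∈FAB with x∈image⁻ (restrictMap F A) B x∈FAB
... | y , y∈B , x∈FAy = x∈image⁺ F B y y∈B (p─q⊆p (F y) (image F A) x∈FAy)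

image-restrictMap-disjoint : ∀ {x} (F : SetMap n p) (A B : Subset n) → x ∈ image F A → x ∉ image (restrictMap F A) B
image-restrictMap-disjoint F A B x∈FA x∈FAB with x∈image⁻ (restrictMap F A) B x∈FAB
... | y , _ , x∈FAy = x∈p─q⇒x∉q (F y) (image F A) x∈FAy x∈FA

image-∪ : (F : SetMap n p) (A B : Subset n) → image F (A ∪ B) ≡ image F A ∪ image (restrictMap F A) B
image-∪ F A B = ⊆-antisym split join
  where
  split : image F (A ∪ B) ⊆ image F A ∪ image (restrictMap F A) B
  split {x} x∈F[A∪B] with x∈image⁻ F (A ∪ B) x∈F[A∪B] | x ∈? image F A
  ... | _ | yes x∈FA = x∈p∪q⁺ (inj₁ x∈FA)
  ... | y , y∈A∪B , x∈Fy | no x∉FA with x∈p∪q⁻ A B y∈A∪B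
  ...   | inj₁ y∈A = ⊥-elim (x∉FA (x∈image⁺ F A y y∈A x∈Fy))
  ...   | inj₂ y∈B = x∈p∪q⁺ (inj₂ (x∈image⁺ (restrictMap F A) B y y∈B (x∈p∧x∉q⇒x∈p─q x∈Fy x∉FA)))
  join : image F A ∪ image (restrictMap F A) B ⊆ image F (A ∪ B)
  join {x} x∈∪ with x∈p∪q⁻ (image F A) _ x∈∪
  ... | inj₁ x∈FA  = image-mono F (p⊆p∪q {p = A} B) x∈FA
  ... | inj₂ x∈FAB = image-mono F (q⊆p∪q A B) (image-restrictMap-⊆ F A B x∈FAB)

∣image-∪∣ : (F : SetMap n p) (A B : Subset n) → ∣ image F (A ∪ B) ∣ ≡ ∣ image F A ∣ + ∣ image (restrictMap F A) B ∣
∣image-∪∣ F A B =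
  trans (cong ∣_∣ (image-∪ F A B)) (∣p∪q∣≡∣p∣+∣q∣ _ _ (image-restrictMap-disjoint F A B))

module _ (W : Fin m → Subset n) where

  x∈prefixUnion⁻ : ∀ {x} i → x ∈ prefixUnion W i → ∃ λ j → toℕ j < i × x ∈ W j
  x∈prefixUnion⁻ i x∈U with x∈⋃-select⁻ (λ j → toℕ j <ᵇ i) W x∈U
  ... | j , j<i , x∈Wj = j , <ᵇ⇒< (toℕ j) i j<i , x∈Wj

  x∈prefixUnion⁺ : ∀ {x} i j → toℕ j < i → x ∈ W j → x ∈ prefixUnion W i
  x∈prefixUnion⁺ i j j<i = x∈⋃-select⁺ (λ j → toℕ j <ᵇ i) W j (<⇒<ᵇ j<i)

  prefixUnion-zero : prefixUnion W 0 ≡ ⊥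
  prefixUnion-zero =
    ⊆-antisym (λ x∈U → ⊥-elim (n≮0 (proj₁ (proj₂ (x∈prefixUnion⁻ 0 x∈U))))) (λ x∈⊥ → ⊥-elim (∉⊥ x∈⊥))

  prefixUnion-suc : ∀ j → prefixUnion W (suc (toℕ j)) ≡ prefixUnion W (toℕ j) ∪ W j
  prefixUnion-suc j = ⊆-antisym split join
    where
    split : prefixUnion W (suc (toℕ j)) ⊆ prefixUnion W (toℕ j) ∪ W j
    split x∈U with x∈prefixUnion⁻ (suc (toℕ j)) x∈U
    ... | i , i<1+j , x∈Wi with m≤n⇒m<n∨m≡n (s≤s⁻¹ i<1+j)
    ...   | inj₁ i<j = x∈p∪q⁺ (inj₁ (x∈prefixUnion⁺ (toℕ j) i i<j x∈Wi))
    ...   | inj₂ i≡j with toℕ-injective i≡j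
    ...     | refl = x∈p∪q⁺ (inj₂ x∈Wi)
    join : prefixUnion W (toℕ j) ∪ W j ⊆ prefixUnion W (suc (toℕ j))
    join x∈∪ with x∈p∪q⁻ (prefixUnion W (toℕ j)) (W j) x∈∪
    ... | inj₂ x∈Wj = x∈prefixUnion⁺ (suc (toℕ j)) j ≤-refl x∈Wj
    ... | inj₁ x∈U with x∈prefixUnion⁻ (toℕ j) x∈U
    ...   | i , i<j , x∈Wi = x∈prefixUnion⁺ (suc (toℕ j)) i (m≤n⇒m≤1+n i<j) x∈Wi

  prefixUnion-full : (∀ x → ∃ λ i → x ∈ W i) → prefixUnion W m ≡ ⊤
  prefixUnion-full covers = ⊆-antisym ⊆⊤ λ {x} _ →
    let i , x∈Wi = covers x in x∈prefixUnion⁺ m i (toℕ<n i) x∈Wi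

  prefixUnion-disjoint : (∀ i j (x : Fin n) → x ∈ W i → x ∈ W j → i ≡ j) →
                         ∀ {x} j → x ∈ prefixUnion W (toℕ j) → x ∉ W j
  prefixUnion-disjoint disjoint j x∈U x∈Wj with x∈prefixUnion⁻ (toℕ j) x∈U
  ... | i , i<j , x∈Wi with disjoint i j _ x∈Wi x∈Wj
  ...   | refl = <-irrefl refl i<j

module HallPartition {k} (F : SetMap n p) (W : Fin (suc k) → Subset n) (H : IsHallPartition F W) where
  open IsHallPartition H

  Balanced : ℕ → Set
  Balanced t = ∣ image F (prefixUnion W t) ∣ ≡ ∣ prefixUnion W t ∣

  ∣prefixUnion-suc∣ : ∀ j → ∣ prefixUnion W (suc (toℕ j)) ∣ ≡ ∣ prefixUnion W (toℕ j) ∣ + ∣ W j ∣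
  ∣prefixUnion-suc∣ j =
    trans (cong ∣_∣ (prefixUnion-suc W j)) (∣p∪q∣≡∣p∣+∣q∣ _ _ (prefixUnion-disjoint W disjoint j))

  ∣image-prefixUnion-suc∣ : ∀ j → ∣ image F (prefixUnion W (suc (toℕ j))) ∣
                                  ≡ ∣ image F (prefixUnion W (toℕ j)) ∣ + ∣ image (stageMap F W j) (W j) ∣
  ∣image-prefixUnion-suc∣ j =
    trans (cong (λ U → ∣ image F U ∣) (prefixUnion-suc W j)) (∣image-∪∣ F (prefixUnion W (toℕ j)) (W j))

  balanced-zero : Balanced 0
  balanced-zero rewrite prefixUnion-zero W | image-⊥ F = trans (∣⊥∣≡0 p) (sym (∣⊥∣≡0 n))

  balanced-suc : ∀ (j : Fin (suc k)) {t} → toℕ j ≡ t → t < k → Balanced t → Balanced (suc t)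
  balanced-suc j refl j<k balanced = begin
    ∣ image F (prefixUnion W (suc (toℕ j))) ∣                           ≡⟨ ∣image-prefixUnion-suc∣ j ⟩
    ∣ image F (prefixUnion W (toℕ j)) ∣ + ∣ image (stageMap F W j) (W j) ∣ ≡⟨ cong₂ _+_ balanced (proj₂ (proj₂ (critical j (s≤s j<k)))) ⟩
    ∣ prefixUnion W (toℕ j) ∣ + ∣ W j ∣                                    ≡⟨ sym (∣prefixUnion-suc∣ j) ⟩
    ∣ prefixUnion W (suc (toℕ j)) ∣                                      ∎
    where open ≡-Reasoning

  balanced : ∀ t → t ≤ k → Balanced t
  balanced zero    _     = balanced-zero
  balanced (suc t) t<k =
    balanced-suc (fromℕ< (s≤s (<⇒≤ t<k))) (toℕ-fromℕ< (s≤s (<⇒≤ t<k))) t<k (balanced t (<⇒≤ t<k))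

  prefixUnion-critical : ∀ i → 1 ≤ toℕ i → IsCritical ⊤ F (prefixUnion W (toℕ i))
  prefixUnion-critical i 1≤i =
    ⊆⊤ , (let y , y∈W₀ = nonempty zero in y , x∈prefixUnion⁺ W (toℕ i) zero 1≤i y∈W₀) ,
    balanced (toℕ i) (s≤s⁻¹ (toℕ<n i))

  last : Fin (suc k)
  last = fromℕ k

  prefixUnion-suc-last : prefixUnion W (suc (toℕ last)) ≡ ⊤
  prefixUnion-suc-last rewrite toℕ-fromℕ k = prefixUnion-full W covers

  split-∣image-⊤∣ : ∣ image F ⊤ ∣ ≡ ∣ prefixUnion W (toℕ last) ∣ + ∣ image (stageMap F W last) (W last) ∣
  split-∣image-⊤∣ = begin
    ∣ image F ⊤ ∣                                                             ≡⟨ cong (λ U → ∣ image F U ∣) (sym prefixUnion-suc-last) ⟩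
    ∣ image F (prefixUnion W (suc (toℕ last))) ∣                              ≡⟨ ∣image-prefixUnion-suc∣ last ⟩
    ∣ image F (prefixUnion W (toℕ last)) ∣ + ∣ image (stageMap F W last) (W last) ∣ ≡⟨ cong (_+ ∣ image (stageMap F W last) (W last) ∣) (balanced (toℕ last) (≤-reflexive (toℕ-fromℕ k))) ⟩
    ∣ prefixUnion W (toℕ last) ∣ + ∣ image (stageMap F W last) (W last) ∣       ∎
    where open ≡-Reasoning

  split-n : n ≡ ∣ prefixUnion W (toℕ last) ∣ + ∣ W last ∣
  split-n = begin
    n                                              ≡⟨ sym (∣⊤∣≡n n) ⟩
    ∣ ⊤ {n} ∣                                      ≡⟨ cong ∣_∣ (sym prefixUnion-suc-last) ⟩
    ∣ prefixUnion W (suc (toℕ last)) ∣             ≡⟨ ∣prefixUnion-suc∣ last ⟩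
    ∣ prefixUnion W (toℕ last) ∣ + ∣ W last ∣       ∎
    where open ≡-Reasoning

  last-critical⇔ : IsCritical (stageDom W last) (stageMap F W last) (W last) ⇔ (∣ image F ⊤ ∣ ≡ n)
  last-critical⇔ = mk⇔ to from
    where
    to : IsCritical (stageDom W last) (stageMap F W last) (W last) → ∣ image F ⊤ ∣ ≡ n
    to (_ , _ , ∣GW∣≡∣W∣) = trans split-∣image-⊤∣ (trans (cong (_ +_) ∣GW∣≡∣W∣) (sym split-n))
    from : ∣ image F ⊤ ∣ ≡ n → IsCritical (stageDom W last) (stageMap F W last) (W last)
    from ∣F⊤∣≡n with nonReduc last
    ... | W⊆dom , W≢∅ , _ =
      W⊆dom , W≢∅ , +-cancelˡ-≡ ∣ prefixUnion W (toℕ last) ∣ _ _ (trans (sym split-∣image-⊤∣) (trans ∣F⊤∣≡n split-n))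

lemma3p5 : ∀ (n p k : ℕ) → 1 ≤ n → 1 ≤ p → (F : SetMap n p) → (W : Fin (suc k) → Subset n) →
    IsHallPartition F W →
    (∀ (i : Fin (suc k)) → 1 ≤ toℕ i → IsCritical ⊤ F (prefixUnion W (toℕ i)))
    × (IsCritical (stageDom W (fromℕ k)) (stageMap F W (fromℕ k)) (W (fromℕ k))
        ⇔ (∣ image F ⊤ ∣ ≡ n))
lemma3p5 n p k _ _ F W H = prefixUnion-critical , last-critical⇔
  where open HallPartition F W H
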